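{- Let $s\ge1$. If $\Gamma$ is a simplicial complex with $|V(\Gamma)|$ odd, then $\bar{\zeta_s}\zeta_s(\Gamma)=\epsilon(\Gamma)$.
   Context: $V(\Gamma)$ is the vertex set; $\Gamma_A=\{X\cap A:X\in\Gamma\}$; a face $X$ has dimension $|X|-1$. $\zeta_s(\Gamma)=1$ if $\dim\Gamma<s$ and $0$ otherwise; $\bar{\zeta_s}(\Gamma)=(-1)^{|V(\Gamma)|}\zeta_s(\Gamma)$; $\bar{\zeta_s}\zeta_s(\Gamma)=\sum_{A\uplus B=V(\Gamma)}\bar{\zeta_s}(\Gamma_A)\zeta_s(\Gamma_B)$ over ordered pairs of disjoint sets with union $V(\Gamma)$. $\epsilon(\Gamma)=1$ if $\Gamma$ has no vertices and $0$ otherwise. -}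

module Defs where

open import Data.Bool using (Bool; true; false; if_then_else_)
open import Data.Nat using (ℕ; zero; suc; _⊔_)
open import Data.Integer using (ℤ; +_; _-_; _*_; _+_; _<?_; 1ℤ; 0ℤ; -1ℤ)
open import Data.Integer using () renaming (_^_ to _^ℤ_)
open import Data.Fin using (Fin)
open import Data.Fin.Subset using (Subset; _⊆_; ⁅_⁆; ∣_∣; _∩_; ∁; ⊥)
open import Data.List using (List; []; _∷_; map; _++_; foldr)
open import Data.Vec using (_∷_)
open import Relation.Binary.PropositionalEquality using (_≡_)
open import Relation.Nullary.Decidable using (does)

-- A simplicial complex whose vertex set V(Γ) is Fin n:
-- a down-closed family of subsets (given by a Boolean membership test),
-- containing ∅ and every singleton.
record SimplicialComplex (n : ℕ) : Set where
  field
    isFace      : Subset n → Bool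
    empty-face  : isFace ⊥ ≡ true
    down-closed : ∀ X Y → X ⊆ Y → isFace Y ≡ true → isFace X ≡ true
    vertex      : ∀ i → isFace ⁅ i ⁆ ≡ true
open SimplicialComplex public

allSubsets : (n : ℕ) → List (Subset n)
allSubsets zero = Data.Vec.[] ∷ []
allSubsets (suc n) = map (true ∷_) (allSubsets n) ++ map (false ∷_) (allSubsets n)

-- max over faces X of Γ of |X ∩ A|  (= largest face size of Γ_A)
maxFaceSize : ∀ {n} → SimplicialComplex n → Subset n → ℕ
maxFaceSize {n} Γ A =
  foldr (λ X m → if isFace Γ X then ∣ X ∩ A ∣ ⊔ m else m) 0 (allSubsets n)

dimRestr : ∀ {n} → SimplicialComplex n → Subset n → ℤ
dimRestr Γ A = + maxFaceSize Γ A - 1ℤ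

ζ : ℕ → ∀ {n} → SimplicialComplex n → Subset n → ℤ
ζ s Γ A = if does (dimRestr Γ A <? + s) then 1ℤ else 0ℤ

-- ζ̄_s(Γ_A) = (-1)^{|V(Γ_A)|} ζ_s(Γ_A), with V(Γ_A) = A
ζbar : ℕ → ∀ {n} → SimplicialComplex n → Subset n → ℤ
ζbar s Γ A = (-1ℤ ^ℤ ∣ A ∣) * ζ s Γ A

-- (ζ̄_s ζ_s)(Γ) = Σ_{A ⊎ B = V(Γ)} ζ̄_s(Γ_A) ζ_s(Γ_B), B = complement of A
ζbarζ : ℕ → ∀ {n} → SimplicialComplex n → ℤ
ζbarζ s {n} Γ = foldr (λ A acc → ζbar s Γ A * ζ s Γ (∁ A) + acc) 0ℤ (allSubsets n)

ε : ∀ {n} → SimplicialComplex n → ℤ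
ε {zero} _ = 1ℤ
ε {suc _} _ = 0ℤ

-- The summand of ζ̄ζ at A is (-1)^|A| ζ(Γ_A) ζ(Γ_∁A).  Complementation A ↦ ∁A is
-- an involution on the subsets of V(Γ) that swaps the two ζ factors and, since
-- |A| + |∁A| = |V(Γ)| is odd, flips the sign.  So the sum equals its own
-- negative, hence is 0 = ε(Γ).
module Submission where

open import Defs
open import Data.Nat using (ℕ; _≤_; _%_)
open import Relation.Binary.PropositionalEquality

open import Data.Nat using (zero; suc)
open import Data.Bool using (true; false; not)
open import Data.Bool.Properties using (not-involutive)
open import Data.Integer using (ℤ; +_; -[1+_]; -_; 0ℤ; -1ℤ; _+_; _*_; _^_)
open import Data.Integer.Properties using (+-identityˡ; +-assoc; +-comm; neg-distrib-+)
open import Data.Integer.Solver using (module +-*-Solver)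
open import Data.Fin.Subset using (Subset; ∁; ∣_∣)
open import Data.List using (List; []; _∷_; map; _++_; foldr)
open import Data.Vec using () renaming ([] to []ᵥ; _∷_ to _∷ᵥ_)
open import Data.Vec.Properties using (map-∘; map-cong; map-id)
open import Function using (_∘_)

open +-*-Solver

∑ : ∀ {n} → (Subset n → ℤ) → List (Subset n) → ℤ
∑ h = foldr (λ A acc → h A + acc) 0ℤ

∑-++ : ∀ {n} (h : Subset n → ℤ) xs ys → ∑ h (xs ++ ys) ≡ ∑ h xs + ∑ h ys
∑-++ h []       ys = sym (+-identityˡ (∑ h ys))
∑-++ h (x ∷ xs) ys = trans (cong (_+_ (h x)) (∑-++ h xs ys)) (sym (+-assoc (h x) _ _))

∑-map : ∀ {m n} (h : Subset n → ℤ) (f : Subset m → Subset n) xs →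
        ∑ h (map f xs) ≡ ∑ (h ∘ f) xs
∑-map h f []       = refl
∑-map h f (x ∷ xs) = cong (_+_ (h (f x))) (∑-map h f xs)

∑-cong : ∀ {n} {h k : Subset n → ℤ} → (∀ A → h A ≡ k A) → ∀ xs → ∑ h xs ≡ ∑ k xs
∑-cong h≗k []       = refl
∑-cong h≗k (x ∷ xs) = cong₂ _+_ (h≗k x) (∑-cong h≗k xs)

∑-neg : ∀ {n} (h : Subset n → ℤ) xs → ∑ (-_ ∘ h) xs ≡ - ∑ h xs
∑-neg h []       = refl
∑-neg h (x ∷ xs) = trans (cong (_+_ (- h x)) (∑-neg h xs)) (sym (neg-distrib-+ (h x) _))

∁-involutive : ∀ {n} (A : Subset n) → ∁ (∁ A) ≡ A
∁-involutive A =
  trans (sym (map-∘ not not A)) (trans (map-cong not-involutive A) (map-id A))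

∑-allSubsets-∘∁ : ∀ n (h : Subset n → ℤ) → ∑ (h ∘ ∁) (allSubsets n) ≡ ∑ h (allSubsets n)
∑-allSubsets-∘∁ zero    h = refl
∑-allSubsets-∘∁ (suc n) h = begin
  ∑ (h ∘ ∁) (map (true ∷ᵥ_) L ++ map (false ∷ᵥ_) L)
    ≡⟨ ∑-++ (h ∘ ∁) (map (true ∷ᵥ_) L) _ ⟩
  ∑ (h ∘ ∁) (map (true ∷ᵥ_) L) + ∑ (h ∘ ∁) (map (false ∷ᵥ_) L)
    ≡⟨ cong₂ _+_ (∑-map (h ∘ ∁) (true ∷ᵥ_) L) (∑-map (h ∘ ∁) (false ∷ᵥ_) L) ⟩
  ∑ (hᶠ ∘ ∁) L + ∑ (hᵗ ∘ ∁) L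
    ≡⟨ cong₂ _+_ (∑-allSubsets-∘∁ n hᶠ) (∑-allSubsets-∘∁ n hᵗ) ⟩
  ∑ hᶠ L + ∑ hᵗ L
    ≡⟨ +-comm (∑ hᶠ L) (∑ hᵗ L) ⟩
  ∑ hᵗ L + ∑ hᶠ L
    ≡⟨ sym (cong₂ _+_ (∑-map h (true ∷ᵥ_) L) (∑-map h (false ∷ᵥ_) L)) ⟩
  ∑ h (map (true ∷ᵥ_) L) + ∑ h (map (false ∷ᵥ_) L)
    ≡⟨ sym (∑-++ h (map (true ∷ᵥ_) L) _) ⟩
  ∑ h (map (true ∷ᵥ_) L ++ map (false ∷ᵥ_) L)
    ∎
  where
  open ≡-Reasoning
  L = allSubsets n
  hᵗ hᶠ : Subset n → ℤ
  hᵗ A = h (true ∷ᵥ A)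
  hᶠ A = h (false ∷ᵥ A)

i≡-i⇒i≡0 : ∀ i → i ≡ - i → i ≡ 0ℤ
i≡-i⇒i≡0 (+ zero)  _  = refl
i≡-i⇒i≡0 (+ suc _) ()
i≡-i⇒i≡0 -[1+ _ ]  ()

∑-allSubsets-≡0 : ∀ n (h : Subset n → ℤ) → (∀ A → h (∁ A) ≡ - h A) →
                  ∑ h (allSubsets n) ≡ 0ℤ
∑-allSubsets-≡0 n h h∁≡-h = i≡-i⇒i≡0 _ (begin
  ∑ h (allSubsets n)        ≡⟨ sym (∑-allSubsets-∘∁ n h) ⟩
  ∑ (h ∘ ∁) (allSubsets n)  ≡⟨ ∑-cong h∁≡-h (allSubsets n) ⟩
  ∑ (-_ ∘ h) (allSubsets n) ≡⟨ ∑-neg h (allSubsets n) ⟩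
  - ∑ h (allSubsets n)      ∎)
  where open ≡-Reasoning

-1^odd : ∀ n → n % 2 ≡ 1 → -1ℤ ^ n ≡ -1ℤ
-1^odd 1             _   = refl
-1^odd (suc (suc n)) odd =
  trans (solve 1 (λ x → con -1ℤ :* (con -1ℤ :* x) := x) refl (-1ℤ ^ n)) (-1^odd n odd)

-1^∣∁p∣ : ∀ {n} (p : Subset n) → -1ℤ ^ ∣ ∁ p ∣ ≡ -1ℤ ^ n * -1ℤ ^ ∣ p ∣
-1^∣∁p∣ []ᵥ = refl
-1^∣∁p∣ {suc n} (true ∷ᵥ p) =
  trans (-1^∣∁p∣ p)
        (solve 2 (λ x y → x :* y := (con -1ℤ :* x) :* (con -1ℤ :* y)) refl (-1ℤ ^ n) _)
-1^∣∁p∣ {suc n} (false ∷ᵥ p) =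
  trans (cong (-1ℤ *_) (-1^∣∁p∣ p))
        (solve 2 (λ x y → con -1ℤ :* (x :* y) := (con -1ℤ :* x) :* y) refl (-1ℤ ^ n) _)

-1^∣∁p∣-odd : ∀ {n} → n % 2 ≡ 1 → (p : Subset n) → -1ℤ ^ ∣ ∁ p ∣ ≡ - (-1ℤ ^ ∣ p ∣)
-1^∣∁p∣-odd {n} odd p = begin
  -1ℤ ^ ∣ ∁ p ∣         ≡⟨ -1^∣∁p∣ p ⟩
  -1ℤ ^ n * -1ℤ ^ ∣ p ∣ ≡⟨ cong (_* -1ℤ ^ ∣ p ∣) (-1^odd n odd) ⟩
  -1ℤ * -1ℤ ^ ∣ p ∣     ≡⟨ solve 1 (λ x → con -1ℤ :* x := :- x) refl (-1ℤ ^ ∣ p ∣) ⟩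
  - (-1ℤ ^ ∣ p ∣)       ∎
  where open ≡-Reasoning

ζbarζ-summand : ℕ → ∀ {n} → SimplicialComplex n → Subset n → ℤ
ζbarζ-summand s Γ A = ζbar s Γ A * ζ s Γ (∁ A)

ζbarζ-summand-∁ : ∀ s {n} (Γ : SimplicialComplex n) → n % 2 ≡ 1 →
                  ∀ A → ζbarζ-summand s Γ (∁ A) ≡ - ζbarζ-summand s Γ A
ζbarζ-summand-∁ s Γ odd A
  rewrite ∁-involutive A | -1^∣∁p∣-odd odd A =
  solve 3 (λ e x y → (:- e) :* y :* x := :- (e :* x :* y)) refl
        (-1ℤ ^ ∣ A ∣) (ζ s Γ A) (ζ s Γ (∁ A))

ζbarζ-odd : ∀ s {n} (Γ : SimplicialComplex n) → n % 2 ≡ 1 → ζbarζ s Γ ≡ 0ℤ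
ζbarζ-odd s {n} Γ odd =
  ∑-allSubsets-≡0 n (ζbarζ-summand s Γ) (ζbarζ-summand-∁ s Γ odd)

lemma6p5 : (s : ℕ) → 1 ≤ s → (n : ℕ) → (Γ : SimplicialComplex n) →
    n % 2 ≡ 1 → ζbarζ s Γ ≡ ε Γ
lemma6p5 s _ (suc n) Γ odd = ζbarζ-odd s Γ odd
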